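{- For $1\leq n\leq 4$, $a_n(231;321)=1$, and for $n\geq 5$, $a_n(231;321)=0$.
   Context: $\mathcal{S}_n$ is the set of permutations of $[n]=\{1,\dots,n\}$, written in one-line notation $\pi=\pi_1\pi_2\cdots\pi_n$ with $\pi_i=\pi(i)$. A permutation is cyclic if it consists of exactly one $n$-cycle. For a cyclic $\pi$, its standard cycle notation is $C(\pi)=(c_1,c_2,\dots,c_n)$ with $c_1=1$ and $c_i=\pi_{c_{i-1}}$ for $2\le i\le n$. A sequence of distinct integers $w_1\cdots w_m$ contains a pattern $\sigma\in\mathcal{S}_k$ if there are indices $i_1<\dots<i_k$ with $w_{i_1}\cdots w_{i_k}$ in the same relative order as $\sigma_1\cdots\sigma_k$; otherwise it avoids $\sigma$. For $\sigma,\tau\in\mathcal{S}_3$, $\mathcal{A}_n(\sigma;\tau)$ is the set of cyclic permutations $\pi\in\mathcal{S}_n$ whose one-line notation avoids $\sigma$ and whose cycle notation $C(\pi)$ (as the sequence $c_1c_2\cdots c_n$) avoids $\tau$; $a_n(\sigma;\tau)=|\mathcal{A}_n(\sigma;\tau)|$. -}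

module Defs where

open import Data.Nat using (ℕ; zero; suc)
open import Data.Fin using (Fin; zero; suc; toℕ; _<_)
open import Data.Product using (Σ; _×_; ∃)
open import Function.Definitions using (Bijective)
open import Relation.Binary.PropositionalEquality using (_≡_)
open import Relation.Nullary using (¬_)

-- A permutation of [n] in one-line notation: a bijective map Fin n → Fin n
-- (position i ↦ value π_i; Fin n = {0,…,n-1} stands for [n] = {1,…,n}).
IsPerm : {n : ℕ} → (Fin n → Fin n) → Set
IsPerm π = Bijective _≡_ _≡_ π

iter : {n : ℕ} → (Fin n → Fin n) → ℕ → Fin n → Fin n
iter π zero    x = x
iter π (suc k) x = π (iter π k x)

-- Standard cycle notation as a sequence: c_1 = 1 (here: zero), c_{i+1} = π(c_i),
-- i.e. the i-th entry (0-based) is π^i(1).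
cycleSeq : {m : ℕ} → (Fin (suc m) → Fin (suc m)) → Fin (suc m) → Fin (suc m)
cycleSeq π i = iter π (toℕ i) zero

-- π is cyclic (a single (m+1)-cycle): the sequence 1, π(1), …, π^{n-1}(1)
-- runs through all of [n].
Cyclic : {m : ℕ} → (Fin (suc m) → Fin (suc m)) → Set
Cyclic π = ∀ j → ∃ λ i → cycleSeq π i ≡ j

Contains : {l n k : ℕ} → (Fin l → Fin n) → (Fin k → Fin k) → Set
Contains {l} {n} {k} w σ =
  Σ (Fin k → Fin l) λ f →
    (∀ a b → a < b → f a < f b) ×
    (∀ a b → (σ a < σ b → w (f a) < w (f b)) × (w (f a) < w (f b) → σ a < σ b))

Avoids : {l n k : ℕ} → (Fin l → Fin n) → (Fin k → Fin k) → Set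
Avoids w σ = ¬ Contains w σ

-- The patterns 231 and 321 (0-based values: 231 ↦ 1 2 0, 321 ↦ 2 1 0).
p231 : Fin 3 → Fin 3
p231 zero             = suc zero
p231 (suc zero)       = suc (suc zero)
p231 (suc (suc zero)) = zero

p321 : Fin 3 → Fin 3
p321 zero             = suc (suc zero)
p321 (suc zero)       = suc zero
p321 (suc (suc zero)) = zero

-- Membership in A_n(σ;τ), n = m+1.
InA : (m : ℕ) → (Fin 3 → Fin 3) → (Fin 3 → Fin 3) → (Fin (suc m) → Fin (suc m)) → Set
InA m σ τ π = IsPerm π × Cyclic π × Avoids π σ × Avoids (cycleSeq π) τ

CountIsOne : (m : ℕ) → (Fin 3 → Fin 3) → (Fin 3 → Fin 3) → Set
CountIsOne m σ τ =
  Σ (Fin (suc m) → Fin (suc m)) λ π →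
    InA m σ τ π × (∀ ρ → InA m σ τ ρ → ∀ i → ρ i ≡ π i)

CountIsZero : (m : ℕ) → (Fin 3 → Fin 3) → (Fin 3 → Fin 3) → Set
CountIsZero m σ τ = ∀ π → ¬ InA m σ τ π

module Submission where

-- Write c k = π^k(0) (0-based, values 0 … m, n = m + 1), so that π (c m) = 0. Avoiding 231 in π
-- forces every position strictly between 0 and c m to be mapped at most to π 0; hence if
-- π 0 < c m the whole orbit stays below π 0 and π 0 = m. Otherwise, if the maximum m were c T
-- with T ≥ 2, a 231 at positions 0 < c (T - 1) < c T would make c T > c (T + 1) > c m a 321 in
-- the cycle. So c 1 = m, and 321-avoidance makes c 2 < ⋯ < c m, i.e. c k = k - 1: the cycle,
-- hence π, is determined. For m ≥ 4 the positions c 2 < c 3 < c m carry the values c 3 < c 4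
-- and 0, a 231; for m ≤ 3 the remaining candidate is checked by a decision procedure.

open import Defs
open import Data.Nat using (ℕ; suc; _≤_)
open import Data.Product using (_×_)
open import Data.Nat as ℕ using (zero; _+_; _∸_; z≤n; s≤s)
import Data.Nat.Properties as ℕ
open import Data.Fin as Fin using (Fin; zero; suc; toℕ; fromℕ)
open import Data.Fin.Patterns using (0F; 1F; 2F; 3F)
open import Data.Fin.Properties
  using (_≟_; _<?_; all?; any?; <-cmp; <-irrefl; <-asym; ≤-antisym; ≤∧≢⇒<; ≤fromℕ;
         toℕ-injective; toℕ-fromℕ; toℕ-fromℕ<; toℕ≤pred[n]; injective⇒≤)
open import Data.Product using (∃; _,_; proj₁; proj₂)
open import Data.Sum using (inj₁; inj₂)
open import Data.Vec.Functional using ([]; _∷_)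
open import Function.Base using (_∘_)
open import Function.Definitions using (Injective; Surjective)
open import Relation.Binary.Definitions using (tri<; tri≈; tri>)
open import Relation.Binary.PropositionalEquality
open import Relation.Nullary using (¬_; Dec; yes; no; contradiction)
open import Relation.Nullary.Decidable using (map′; _×-dec_; _→-dec_; ¬?; from-yes)

Occurrence : {l n k : ℕ} → (Fin l → Fin n) → (Fin k → Fin k) → (Fin k → Fin l) → Set
Occurrence w σ f =
  (∀ a b → a Fin.< b → f a Fin.< f b) ×
  (∀ a b → (σ a Fin.< σ b → w (f a) Fin.< w (f b)) × (w (f a) Fin.< w (f b) → σ a Fin.< σ b))

occurrence-cong : {l n k : ℕ} {w : Fin l → Fin n} {σ : Fin k → Fin k} {f g : Fin k → Fin l} →
                  f ≗ g → Occurrence w σ f → Occurrence w σ g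
occurrence-cong {w = w} f≗g (increasing , iso) =
  (λ a b a<b → subst₂ Fin._<_ (f≗g a) (f≗g b) (increasing a b a<b)) ,
  (λ a b → (λ σa<σb → along (f≗g a) (f≗g b) (proj₁ (iso a b) σa<σb)) ,
           (λ wga<wgb → proj₂ (iso a b) (along (sym (f≗g a)) (sym (f≗g b)) wga<wgb)))
  where
  along : ∀ {x x′ y y′} → x ≡ x′ → y ≡ y′ → w x Fin.< w y → w x′ Fin.< w y′
  along refl refl w<w = w<w

occurrence? : {l n k : ℕ} (w : Fin l → Fin n) (σ : Fin k → Fin k) (f : Fin k → Fin l) →
              Dec (Occurrence w σ f)
occurrence? w σ f =
  (all? λ a → all? λ b → (a <? b) →-dec (f a <? f b)) ×-dec
  (all? λ a → all? λ b → ((σ a <? σ b) →-dec (w (f a) <? w (f b))) ×-dec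
                         ((w (f a) <? w (f b)) →-dec (σ a <? σ b)))

triple-η : {l : ℕ} (f : Fin 3 → Fin l) → f ≗ (f 0F ∷ f 1F ∷ f 2F ∷ [])
triple-η f 0F = refl
triple-η f 1F = refl
triple-η f 2F = refl

contains? : {l n : ℕ} (w : Fin l → Fin n) (σ : Fin 3 → Fin 3) → Dec (Contains w σ)
contains? w σ =
  map′ (λ (i , j , k , occ) → (i ∷ j ∷ k ∷ []) , occ)
       (λ (f , occ) → f 0F , f 1F , f 2F , occurrence-cong {w = w} (triple-η f) occ)
       (any? λ i → any? λ j → any? λ k → occurrence? w σ (i ∷ j ∷ k ∷ []))

injective? : {m n : ℕ} (f : Fin m → Fin n) → Dec (Injective _≡_ _≡_ f)
injective? f = map′ (λ inj {x} {y} → inj x y) (λ inj x y → inj)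
                    (all? λ x → all? λ y → (f x ≟ f y) →-dec (x ≟ y))

surjective? : {m n : ℕ} (f : Fin m → Fin n) → Dec (Surjective _≡_ _≡_ f)
surjective? f = map′ (λ surj y → proj₁ (surj y) , λ { refl → proj₂ (surj y) })
                     (λ surj y → proj₁ (surj y) , proj₂ (surj y) refl)
                     (all? λ y → any? λ x → f x ≟ y)

cyclic? : {m : ℕ} (π : Fin (suc m) → Fin (suc m)) → Dec (Cyclic π)
cyclic? π = all? λ j → any? λ i → cycleSeq π i ≟ j

inA? : (m : ℕ) (σ τ : Fin 3 → Fin 3) (π : Fin (suc m) → Fin (suc m)) → Dec (InA m σ τ π)
inA? m σ τ π = (injective? π ×-dec surjective? π) ×-dec cyclic? π ×-dec
               ¬? (contains? π σ) ×-dec ¬? (contains? (cycleSeq π) τ)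

occurrence-from-forward : {l n k : ℕ} {w : Fin l → Fin n} {σ : Fin k → Fin k} {f : Fin k → Fin l} →
  Injective _≡_ _≡_ σ → (∀ a b → a Fin.< b → f a Fin.< f b) →
  (∀ a b → σ a Fin.< σ b → w (f a) Fin.< w (f b)) → Occurrence w σ f
occurrence-from-forward {w = w} {σ} {f} σ-injective increasing forward =
  increasing , λ a b → forward a b , backward a b
  where
  backward : ∀ a b → w (f a) Fin.< w (f b) → σ a Fin.< σ b
  backward a b wfa<wfb with <-cmp (σ a) (σ b)
  ... | tri< σa<σb _ _ = σa<σb
  ... | tri≈ _ σa≡σb _ = contradiction wfa<wfb (<-irrefl (cong (w ∘ f) (σ-injective σa≡σb)))
  ... | tri> _ _ σb<σa = contradiction (forward b a σb<σa) (<-asym wfa<wfb)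

triple-increasing : {l : ℕ} {i j k : Fin l} → i Fin.< j → j Fin.< k →
                    ∀ a b → a Fin.< b → (i ∷ j ∷ k ∷ []) a Fin.< (i ∷ j ∷ k ∷ []) b
triple-increasing i<j j<k 0F 1F _ = i<j
triple-increasing i<j j<k 0F 2F _ = ℕ.<-trans i<j j<k
triple-increasing i<j j<k 1F 2F _ = j<k
triple-increasing i<j j<k 0F 0F ()
triple-increasing i<j j<k 1F 0F ()
triple-increasing i<j j<k 1F 1F (s≤s ())
triple-increasing i<j j<k 2F 0F ()
triple-increasing i<j j<k 2F 1F (s≤s ())
triple-increasing i<j j<k 2F 2F (s≤s (s≤s ()))

contains231 : {l n : ℕ} (w : Fin l → Fin n) {i j k : Fin l} → i Fin.< j → j Fin.< k →
              w k Fin.< w i → w i Fin.< w j → Contains w p231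
contains231 w {i} {j} {k} i<j j<k wk<wi wi<wj =
  _ , occurrence-from-forward {w = w} (from-yes (injective? p231)) (triple-increasing i<j j<k) forward
  where
  forward : ∀ a b → p231 a Fin.< p231 b → w ((i ∷ j ∷ k ∷ []) a) Fin.< w ((i ∷ j ∷ k ∷ []) b)
  forward 0F 1F _ = wi<wj
  forward 2F 0F _ = wk<wi
  forward 2F 1F _ = ℕ.<-trans wk<wi wi<wj
  forward 0F 0F (s≤s ())
  forward 0F 2F ()
  forward 1F 0F (s≤s ())
  forward 1F 1F (s≤s (s≤s ()))
  forward 1F 2F ()
  forward 2F 2F ()

contains321 : {l n : ℕ} (w : Fin l → Fin n) {i j k : Fin l} → i Fin.< j → j Fin.< k →
              w k Fin.< w j → w j Fin.< w i → Contains w p321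
contains321 w {i} {j} {k} i<j j<k wk<wj wj<wi =
  _ , occurrence-from-forward {w = w} (from-yes (injective? p321)) (triple-increasing i<j j<k) forward
  where
  forward : ∀ a b → p321 a Fin.< p321 b → w ((i ∷ j ∷ k ∷ []) a) Fin.< w ((i ∷ j ∷ k ∷ []) b)
  forward 1F 0F _ = wj<wi
  forward 2F 1F _ = wk<wj
  forward 2F 0F _ = ℕ.<-trans wk<wj wj<wi
  forward 0F 0F (s≤s (s≤s ()))
  forward 0F 1F (s≤s ())
  forward 0F 2F ()
  forward 1F 1F (s≤s ())
  forward 1F 2F ()
  forward 2F 2F ()

≢zero⇒0<toℕ : {n : ℕ} {x : Fin (suc n)} → x ≢ zero → 0 ℕ.< toℕ x
≢zero⇒0<toℕ x≢0 = ≤∧≢⇒< z≤n (≢-sym x≢0)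

≢fromℕ⇒<fromℕ : {n : ℕ} {x : Fin (suc n)} → x ≢ fromℕ n → x Fin.< fromℕ n
≢fromℕ⇒<fromℕ {x = x} x≢max = ≤∧≢⇒< (≤fromℕ x) x≢max

module Orbit {m : ℕ} (π : Fin (suc m) → Fin (suc m)) (π-injective : Injective _≡_ _≡_ π)
             (cyclic : Cyclic π) where

  c : ℕ → Fin (suc m)
  c k = iter π k zero

  c-surjective : ∀ x → ∃ λ k → k ≤ m × c k ≡ x
  c-surjective x = toℕ (proj₁ (cyclic x)) , toℕ≤pred[n] (proj₁ (cyclic x)) , proj₂ (cyclic x)

  c-cancel : ∀ i d → c (i + d) ≡ c i → c d ≡ zero
  c-cancel zero    d eq = eq
  c-cancel (suc i) d eq = c-cancel i d (π-injective eq)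

  c-in-first-period : ∀ {d} → c (suc d) ≡ zero → ∀ k → ∃ λ r → r ≤ d × c r ≡ c k
  c-in-first-period returns zero = 0 , z≤n , refl
  c-in-first-period returns (suc k) with c-in-first-period returns k
  ... | r , r≤d , cr≡ck with ℕ.m≤n⇒m<n∨m≡n r≤d
  ...   | inj₁ r<d  = suc r , r<d , cong π cr≡ck
  ...   | inj₂ refl = 0 , z≤n , trans (sym returns) (cong π cr≡ck)

  -- An orbit of 0 closing after d ≤ m steps would have at most d points, but it covers all m + 1.
  no-early-return : ∀ {d} → 0 ℕ.< d → d ≤ m → c d ≢ zero
  no-early-return {suc d} _ d<m returns =
    ℕ.<⇒≱ d<m (ℕ.s≤s⁻¹ (injective⇒≤ index-injective))
    where
    index : ∀ x → ∃ λ (r : Fin (suc d)) → c (toℕ r) ≡ x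
    index x = let (k , _ , ck≡x)      = c-surjective x
                  (r , r≤d , cr≡ck) = c-in-first-period returns k
              in Fin.fromℕ< (s≤s r≤d) , trans (cong c (toℕ-fromℕ< (s≤s r≤d))) (trans cr≡ck ck≡x)
    index-injective : Injective _≡_ _≡_ (proj₁ ∘ index)
    index-injective {x} {y} eq =
      trans (sym (proj₂ (index x))) (trans (cong (c ∘ toℕ) eq) (proj₂ (index y)))

  c-distinct : ∀ {i j} → i ℕ.< j → j ≤ m → c i ≢ c j
  c-distinct {i} {j} i<j j≤m ci≡cj =
    no-early-return (ℕ.m<n⇒0<n∸m i<j) (ℕ.≤-trans (ℕ.m∸n≤m j i) j≤m)
      (c-cancel i (j ∸ i) (trans (cong c (ℕ.m+[n∸m]≡n (ℕ.<⇒≤ i<j))) (sym ci≡cj)))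

  c-injective : ∀ {i j} → i ≤ m → j ≤ m → c i ≡ c j → i ≡ j
  c-injective {i} {j} i≤m j≤m ci≡cj with ℕ.<-cmp i j
  ... | tri< i<j _ _ = contradiction ci≡cj (c-distinct i<j j≤m)
  ... | tri≈ _ i≡j _ = i≡j
  ... | tri> _ _ j<i = contradiction (sym ci≡cj) (c-distinct j<i i≤m)

  c<c-max : ∀ {j k} → j ≤ m → k ≤ m → j ≢ k → c k ≡ fromℕ m → c j Fin.< c k
  c<c-max {j} j≤m k≤m j≢k ck≡max = subst (c j Fin.<_) (sym ck≡max)
    (≢fromℕ⇒<fromℕ (λ cj≡max → j≢k (c-injective j≤m k≤m (trans cj≡max (sym ck≡max)))))

  c-returns : c (suc m) ≡ zero
  c-returns with c-surjective (c (suc m))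
  ... | zero  , _   , c0≡c1+m   = sym c0≡c1+m
  ... | suc k , k<m , c1+k≡c1+m =
    contradiction (c-injective (ℕ.<⇒≤ k<m) ℕ.≤-refl (π-injective c1+k≡c1+m)) (ℕ.<⇒≢ k<m)

module Avoiding {m : ℕ} (π : Fin (suc m) → Fin (suc m)) (π-injective : Injective _≡_ _≡_ π)
                (cyclic : Cyclic π)
                (avoids231 : Avoids π p231) (avoids321 : Avoids (cycleSeq π) p321) where
  open Orbit π π-injective cyclic

  no231 : ∀ {i j k} → i Fin.< j → j Fin.< k → π k Fin.< π i → ¬ π i Fin.< π j
  no231 i<j j<k πk<πi πi<πj = avoids231 (contains231 π i<j j<k πk<πi πi<πj)

  no321 : ∀ {i j k} → i ℕ.< j → j ℕ.< k → k ≤ m → c k Fin.< c j → ¬ c j Fin.< c i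
  no321 {i} {j} {k} i<j j<k k≤m ck<cj cj<ci =
    avoids321 (contains321 (cycleSeq π) (at-< i≤m j≤m i<j) (at-< j≤m k≤m j<k)
                                        (cycleSeq-at-< k≤m j≤m ck<cj) (cycleSeq-at-< j≤m i≤m cj<ci))
    where
    j≤m = ℕ.≤-trans (ℕ.<⇒≤ j<k) k≤m
    i≤m = ℕ.≤-trans (ℕ.<⇒≤ i<j) j≤m
    at : ∀ {r} → r ≤ m → Fin (suc m)
    at r≤m = Fin.fromℕ< (s≤s r≤m)
    toℕ-at : ∀ {r} (r≤m : r ≤ m) → r ≡ toℕ (at r≤m)
    toℕ-at r≤m = sym (toℕ-fromℕ< (s≤s r≤m))
    at-< : ∀ {r s} (r≤m : r ≤ m) (s≤m : s ≤ m) → r ℕ.< s → at r≤m Fin.< at s≤m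
    at-< r≤m s≤m = subst₂ ℕ._<_ (toℕ-at r≤m) (toℕ-at s≤m)
    cycleSeq-at-< : ∀ {r s} (r≤m : r ≤ m) (s≤m : s ≤ m) →
                    c r Fin.< c s → cycleSeq π (at r≤m) Fin.< cycleSeq π (at s≤m)
    cycleSeq-at-< r≤m s≤m = subst₂ (λ a b → c a Fin.< c b) (toℕ-at r≤m) (toℕ-at s≤m)

  π0≢0 : 1 ≤ m → π 0F ≢ zero
  π0≢0 1≤m = no-early-return (s≤s z≤n) 1≤m

  below-last : 1 ≤ m → ∀ {x} → 0 ℕ.< toℕ x → x Fin.< c m → π x Fin.≤ π 0F
  below-last 1≤m 0<x x<cm = ℕ.≮⇒≥ (no231 {i = 0F} 0<x x<cm π[cm]<π0)
    where
    π[cm]<π0 : π (c m) Fin.< π 0F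
    π[cm]<π0 = subst (Fin._< π 0F) (sym c-returns) (≢zero⇒0<toℕ (π0≢0 1≤m))

  orbit-below-π0 : 1 ≤ m → π 0F Fin.< c m → ∀ k → c k Fin.≤ π 0F
  orbit-below-π0 _   _     zero = z≤n
  orbit-below-π0 1≤m π0<cm (suc k) with c k ≟ zero
  ... | yes ck≡0 = ℕ.≤-reflexive (cong (toℕ ∘ π) ck≡0)
  ... | no  ck≢0 =
    below-last 1≤m (≢zero⇒0<toℕ ck≢0) (ℕ.≤-<-trans (orbit-below-π0 1≤m π0<cm k) π0<cm)

  -- For the maximum at c T with T ≥ 2: a 231 at 0 < c (T - 1) < c T forces π 0 ≤ c (T + 1),
  -- and then c T > c (T + 1) > c m is a 321.
  no-late-max : 1 ≤ m → c m Fin.≤ π 0F → π 0F ≢ fromℕ m →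
                ∀ {t} → suc (suc t) ≤ m → c (suc (suc t)) ≢ fromℕ m
  no-late-max 1≤m cm≤π0 π0≢max {t} T≤m cT≡max = no321 (ℕ.n<1+n T) 1+T<m ℕ.≤-refl cm<u u<cT
    where
    T = suc (suc t)
    x = c (suc t)
    u = c (suc T)
    0<x : 0 ℕ.< toℕ x
    0<x = ≢zero⇒0<toℕ (no-early-return (s≤s z≤n) (ℕ.<⇒≤ T≤m))
    x<cT : x Fin.< c T
    x<cT = c<c-max (ℕ.<⇒≤ T≤m) T≤m (ℕ.<⇒≢ (ℕ.n<1+n _)) cT≡max
    π0<cT : π 0F Fin.< c T
    π0<cT = subst (π 0F Fin.<_) (sym cT≡max) (≢fromℕ⇒<fromℕ π0≢max)
    π0≤u : π 0F Fin.≤ u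
    π0≤u = ℕ.≮⇒≥ λ u<π0 → no231 {i = 0F} 0<x x<cT u<π0 π0<cT
    T≢m : T ≢ m
    T≢m T≡m = π0≢0 1≤m (toℕ-injective (ℕ.n≤0⇒n≡0
      (subst (π 0F Fin.≤_) (trans (cong (c ∘ suc) T≡m) c-returns) π0≤u)))
    1+T≤m : suc T ≤ m
    1+T≤m = ℕ.≤∧≢⇒< T≤m T≢m
    cm<u : c m Fin.< u
    cm<u = ℕ.≤-<-trans cm≤π0 (≤∧≢⇒< π0≤u (c-distinct (s≤s (s≤s z≤n)) 1+T≤m))
    1+T<m : suc T ℕ.< m
    1+T<m = ℕ.≤∧≢⇒< 1+T≤m (λ 1+T≡m → ℕ.<⇒≢ cm<u (cong (toℕ ∘ c) (sym 1+T≡m)))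
    u<cT : u Fin.< c T
    u<cT = c<c-max 1+T≤m T≤m (ℕ.<⇒≢ (ℕ.n<1+n T) ∘ sym) cT≡max

  π0≡max-if-last-below : 1 ≤ m → c m Fin.≤ π 0F → π 0F ≡ fromℕ m
  π0≡max-if-last-below 1≤m cm≤π0 with π 0F ≟ fromℕ m
  ... | yes π0≡max = π0≡max
  ... | no  π0≢max with c-surjective (fromℕ m)
  ...   | zero        , _   , 0≡max  =
    contradiction (trans (cong toℕ 0≡max) (toℕ-fromℕ m)) (ℕ.<⇒≢ 1≤m)
  ...   | suc zero    , _   , π0≡max = contradiction π0≡max π0≢max
  ...   | suc (suc t) , T≤m , cT≡max = contradiction cT≡max (no-late-max 1≤m cm≤π0 π0≢max T≤m)

  π0≡max : 1 ≤ m → π 0F ≡ fromℕ m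
  π0≡max 1≤m with π 0F <? c m
  ... | no  π0≮cm = π0≡max-if-last-below 1≤m (ℕ.≮⇒≥ π0≮cm)
  ... | yes π0<cm = let (T , _ , cT≡max) = c-surjective (fromℕ m) in
    ≤-antisym (≤fromℕ _) (subst (Fin._≤ π 0F) cT≡max (orbit-below-π0 1≤m π0<cm T))

  c-increasing : ∀ {j k} → 2 ≤ j → j ℕ.< k → k ≤ m → c j Fin.< c k
  c-increasing {j} {k} 2≤j j<k k≤m =
    ≤∧≢⇒< (ℕ.≮⇒≥ λ ck<cj → no321 2≤j j<k k≤m ck<cj cj<c1) (c-distinct j<k k≤m)
    where
    j≤m = ℕ.≤-trans (ℕ.<⇒≤ j<k) k≤m
    1≤m = ℕ.≤-trans (ℕ.<⇒≤ 2≤j) j≤m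
    cj<c1 : c j Fin.< c 1
    cj<c1 = c<c-max j≤m 1≤m (ℕ.<⇒≢ 2≤j ∘ sym) (π0≡max 1≤m)

  c-grows : ∀ d {j} → 2 ≤ j → d + j ≤ m → d + toℕ (c j) ≤ toℕ (c (d + j))
  c-grows zero    2≤j _        = ℕ.≤-refl
  c-grows (suc d) 2≤j 1+d+j≤m = ℕ.≤-<-trans (c-grows d 2≤j (ℕ.<⇒≤ 1+d+j≤m))
    (c-increasing (ℕ.≤-trans 2≤j (ℕ.m≤n+m _ d)) (ℕ.n<1+n _) 1+d+j≤m)

  c-value : ∀ i → 2 + i ≤ m → toℕ (c (2 + i)) ≡ suc i
  c-value i 2+i≤m = ℕ.≤-antisym (ℕ.s≤s⁻¹ upper) lower
    where
    open ℕ.≤-Reasoning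
    2≤m = ℕ.≤-trans (ℕ.m≤m+n 2 i) 2+i≤m
    1≤m = ℕ.<⇒≤ 2≤m
    d = m ∸ (2 + i)
    d+2+i≡m : d + (2 + i) ≡ m
    d+2+i≡m = ℕ.m∸n+n≡m 2+i≤m
    cm<m : toℕ (c m) ℕ.< m
    cm<m = subst (toℕ (c m) ℕ.<_) (trans (cong toℕ (π0≡max 1≤m)) (toℕ-fromℕ m))
                 (c<c-max ℕ.≤-refl 1≤m (ℕ.<⇒≢ 2≤m ∘ sym) (π0≡max 1≤m))
    upper : toℕ (c (2 + i)) ℕ.< 2 + i
    upper = ℕ.+-cancelˡ-< d _ _ (begin-strict
      d + toℕ (c (2 + i))    ≤⟨ c-grows d (ℕ.m≤m+n 2 i) (ℕ.≤-reflexive d+2+i≡m) ⟩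
      toℕ (c (d + (2 + i)))  ≡⟨ cong (toℕ ∘ c) d+2+i≡m ⟩
      toℕ (c m)              <⟨ cm<m ⟩
      m                      ≡⟨ sym d+2+i≡m ⟩
      d + (2 + i)            ∎)
    lower : suc i ≤ toℕ (c (2 + i))
    lower = begin
      suc i            ≡⟨ ℕ.+-comm 1 i ⟩
      i + 1            ≤⟨ ℕ.+-monoʳ-≤ i (≢zero⇒0<toℕ (no-early-return (s≤s z≤n) 2≤m)) ⟩
      i + toℕ (c 2)    ≤⟨ c-grows i ℕ.≤-refl (subst (_≤ m) (ℕ.+-comm 2 i) 2+i≤m) ⟩
      toℕ (c (i + 2))  ≡⟨ cong (toℕ ∘ c) (ℕ.+-comm i 2) ⟩
      toℕ (c (2 + i))  ∎

  -- Positions c 2 < c 3 < c m carry the values c 3 < c 4 and 0.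
  at-most-four-points : m ≤ 3
  at-most-four-points = ℕ.≮⇒≥ λ 3<m →
    no231 (c-increasing ℕ.≤-refl (ℕ.n<1+n 2) (ℕ.<⇒≤ 3<m))
          (c-increasing (ℕ.n≤1+n 2) 3<m ℕ.≤-refl)
          (subst (Fin._< c 3) (sym c-returns)
                 (≢zero⇒0<toℕ (no-early-return (s≤s z≤n) (ℕ.<⇒≤ 3<m))))
          (c-increasing (ℕ.n≤1+n 2) (ℕ.n<1+n 3) 3<m)

same-cycle⇒equal : {m : ℕ} {ρ σ : Fin (suc m) → Fin (suc m)} →
  Injective _≡_ _≡_ ρ → Cyclic ρ → Injective _≡_ _≡_ σ → Cyclic σ →
  (∀ k → k ≤ m → iter ρ k zero ≡ iter σ k zero) → ∀ x → ρ x ≡ σ x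
same-cycle⇒equal {m} {ρ} {σ} ρ-injective ρ-cyclic σ-injective σ-cyclic same x =
  let (k , k≤m , cρk≡x) = R.c-surjective x in subst (λ y → ρ y ≡ σ y) cρk≡x (agree-on-orbit k≤m)
  where
  module R = Orbit ρ ρ-injective ρ-cyclic
  module S = Orbit σ σ-injective σ-cyclic
  same-next : ∀ {k} → k ≤ m → R.c (suc k) ≡ S.c (suc k)
  same-next k≤m with ℕ.m≤n⇒m<n∨m≡n k≤m
  ... | inj₁ k<m  = same _ k<m
  ... | inj₂ refl = trans R.c-returns (sym S.c-returns)
  agree-on-orbit : ∀ {k} → k ≤ m → ρ (R.c k) ≡ σ (R.c k)
  agree-on-orbit {k} k≤m = trans (same-next k≤m) (cong σ (sym (same k k≤m)))

A-subsingleton : {m : ℕ} {ρ σ : Fin (suc m) → Fin (suc m)} →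
                 InA m p231 p321 ρ → InA m p231 p321 σ → ∀ x → ρ x ≡ σ x
A-subsingleton {m} {ρ} {σ} ((ρ-injective , _) , ρ-cyclic , ρ-avoids231 , ρ-avoids321)
                           ((σ-injective , _) , σ-cyclic , σ-avoids231 , σ-avoids321) =
  same-cycle⇒equal ρ-injective ρ-cyclic σ-injective σ-cyclic same
  where
  module R = Avoiding ρ ρ-injective ρ-cyclic ρ-avoids231 ρ-avoids321
  module S = Avoiding σ σ-injective σ-cyclic σ-avoids231 σ-avoids321
  same : ∀ k → k ≤ m → iter ρ k zero ≡ iter σ k zero
  same zero          _     = refl
  same (suc zero)    1≤m   = trans (R.π0≡max 1≤m) (sym (S.π0≡max 1≤m))
  same (suc (suc i)) 2+i≤m = toℕ-injective (trans (R.c-value i 2+i≤m) (sym (S.c-value i 2+i≤m)))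

countIsOne : {m : ℕ} {π : Fin (suc m) → Fin (suc m)} → InA m p231 p321 π → CountIsOne m p231 p321
countIsOne π∈A = _ , π∈A , λ ρ ρ∈A → A-subsingleton ρ∈A π∈A

theorem6p14 : ((m : ℕ) → suc m ≤ 4 → CountIsOne m p231 p321)
            × ((m : ℕ) → 5 ≤ suc m → CountIsZero m p231 p321)
theorem6p14 = one , none
  where
  one : (m : ℕ) → suc m ≤ 4 → CountIsOne m p231 p321
  one 0 _ = countIsOne (from-yes (inA? 0 p231 p321 (0F ∷ [])))
  one 1 _ = countIsOne (from-yes (inA? 1 p231 p321 (1F ∷ 0F ∷ [])))
  one 2 _ = countIsOne (from-yes (inA? 2 p231 p321 (2F ∷ 0F ∷ 1F ∷ [])))
  one 3 _ = countIsOne (from-yes (inA? 3 p231 p321 (3F ∷ 2F ∷ 0F ∷ 1F ∷ [])))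
  one (suc (suc (suc (suc _)))) (s≤s (s≤s (s≤s (s≤s ()))))
  none : (m : ℕ) → 5 ≤ suc m → CountIsZero m p231 p321
  none m 5≤1+m π ((π-injective , _) , cyclic , avoids231 , avoids321) =
    ℕ.<⇒≱ (ℕ.s≤s⁻¹ 5≤1+m) (Avoiding.at-most-four-points π π-injective cyclic avoids231 avoids321)
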